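{- Let $n=6k+r$ with integers $k\ge 1$ and $r\in\{0,1,\dots,5\}$. Then $$\gamma_{OLD}(M(P_n))\ge\begin{cases}4k+r+1 & \text{if } r\in\{0,1,2,3,4\},\\ 4k+5 & \text{if } r=5.\end{cases}$$ Moreover, for every $n\ge 3$ with $n\neq 4$, $$\gamma_{OLD}(M(C_n))\ge\begin{cases}\left\lceil \frac{2n}{3}\right\rceil+1 & \text{if } n \text{ is odd},\\[2pt] 2\left\lceil \frac{n}{3}\right\rceil+1 & \text{if } n \text{ is even}.\end{cases}$$
   Context: All graphs are finite, simple and connected. For a graph $G=(V,E)$ and $x\in V$, $N(x)$ is the open neighbourhood. A set $C\subseteq V$ is an open locating-dominating set ($OLD$-set) if $N(x)\cap C\neq\emptyset$ for all $x\in V$ and $N(x)\cap C\neq N(y)\cap C$ for all distinct $x,y\in V$; $\gamma_{OLD}(G)$ is the minimum size of an $OLD$-set. $P_n$ is the path and $C_n$ the cycle on $n$ vertices. The Mycielski graph $M(G)$ of $G$ with $V=\{v_1,\dots,v_n\}$ is obtained from $G$ by adding, for each $i$, a new vertex $u_i$ adjacent to every vertex of $N_G(v_i)$, and then adding one further vertex $u$ adjacent to all of $u_1,\dots,u_n$ (and to nothing else). -}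

module Defs where

open import Data.Nat using (ℕ; zero; suc; _+_; _*_; _≤_; _<_; _≡ᵇ_)
open import Data.Nat.DivMod using (_/_)
open import Data.Fin using (Fin; toℕ)
open import Data.List using (List; length)
open import Data.List.Membership.Propositional using (_∈_)
open import Data.List.Relation.Unary.Unique.Propositional using (Unique)
open import Data.Product using (_×_)
open import Data.Sum using (_⊎_)
open import Data.Empty using (⊥)
open import Data.Unit using (⊤)
open import Data.Bool using (if_then_else_)
open import Function.Bundles using (_⇔_)
open import Relation.Nullary using (¬_)
open import Relation.Binary.PropositionalEquality using (_≡_; _≢_)

-- A graph on vertex type V is given by its (symmetric, irreflexive) adjacency relation.
Graph : Set → Set₁
Graph V = V → V → Set

Path : (n : ℕ) → Graph (Fin n)
Path n i j = (suc (toℕ i) ≡ toℕ j) ⊎ (suc (toℕ j) ≡ toℕ i)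

Cycle : (n : ℕ) → Graph (Fin n)
Cycle n i j = Path n i j
            ⊎ ((toℕ i ≡ 0 × suc (toℕ j) ≡ n) ⊎ (toℕ j ≡ 0 × suc (toℕ i) ≡ n))

-- Vertices of the Mycielski graph: v_i (copy of G), u_i (shadow), and u (root).
data MV (V : Set) : Set where
  vtx    : V → MV V
  shadow : V → MV V
  root   : MV V

Mycielski : {V : Set} → Graph V → Graph (MV V)
Mycielski G (vtx i)    (vtx j)    = G i j
Mycielski G (vtx i)    (shadow j) = G i j
Mycielski G (shadow i) (vtx j)    = G i j
Mycielski G (shadow i) (shadow j) = ⊥
Mycielski G (shadow i) root       = ⊤
Mycielski G root       (shadow j) = ⊤
Mycielski G (vtx i)    root       = ⊥
Mycielski G root       (vtx j)    = ⊥
Mycielski G root       root       = ⊥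

NC : {V : Set} → Graph V → List V → V → V → Set
NC G C x z = G x z × z ∈ C

-- C is an open locating-dominating set of G (C given as a duplicate-free list).
IsOLD : {V : Set} → Graph V → List V → Set
IsOLD {V} G C =
  Unique C
  × ((x : V) → Σ' x)
  × ((x y : V) → x ≢ y → ¬ ((z : V) → NC G C x z ⇔ NC G C y z))
  where
  Σ' : V → Set
  Σ' x = Data.Product.∃ λ z → NC G C x z

γOLD≥ : {V : Set} → Graph V → ℕ → Set
γOLD≥ {V} G b = (C : List V) → IsOLD G C → b ≤ length C

-- Lower bound for M(P_n), n = 6k + r.
pathBound : ℕ → ℕ → ℕ
pathBound k r = if r ≡ᵇ 5 then 4 * k + 5 else 4 * k + r + 1

ceil3 : ℕ → ℕ
ceil3 a = (a + 2) / 3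

isOdd : ℕ → Data.Bool.Bool
isOdd zero = Data.Bool.false
isOdd (suc n) = Data.Bool.not (isOdd n)

cycleBound : ℕ → ℕ
cycleBound n = if isOdd n then ceil3 (2 * n) + 1 else 2 * ceil3 n + 1

{-# OPTIONS --safe #-}
-- Let C be an OLD-set of M(G) for G a path or a cycle, and mark the positions of the vertices v_j in C.
-- The shadow u_x is adjacent to the root and to N_G(x), so within C it sees the root and the marks at
-- the two neighbours of x. Hence (i) if neither neighbour of x is marked, the root lies in C, and this
-- happens for at most one x, since two such shadows would see the same set; (ii) a mark at b between
-- unmarked b − 2 and b + 2 is impossible, as the shadows of b − 1 and b + 1 would both see exactly v_b.
-- Counting marks under these local rules gives the bounds: along a path every six consecutive
-- positions need four marks; around a cycle each triple i, i + 2, i + 4 carries at least two marks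
-- or uncovered pairs, so summing over i gives 2n ≤ 3·|marks| + 2·|uncovered pairs|, and for even n the
-- even and odd positions form two cycles of length n / 2. One further vertex of C is a shadow, which
-- is needed to dominate the root.
module Submission where

open import Defs
open import Data.Bool using (Bool; true; false; _∨_; not)
open import Data.Bool.Properties
  using (∨-zeroʳ; ∨-identityʳ; ∨-conicalˡ; ∨-conicalʳ; ¬-not; not-injective; not-involutive; T-≡)
  renaming (_≟_ to _≟ᵇ_)
open import Data.Empty using (⊥; ⊥-elim)
open import Data.Fin using (Fin; toℕ; fromℕ<) renaming (_≟_ to _≟ᶠ_)
open import Data.Fin.Properties using (toℕ-fromℕ<; toℕ<n)
open import Data.List using (List; []; _∷_; length)
open import Data.List.Membership.Propositional using (_∈_)
open import Data.List.Relation.Unary.Any using (here; there)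
open import Data.Nat
open import Data.Nat.DivMod
open import Data.Nat.Properties
open import Algebra.Properties.CommutativeSemigroup +-commutativeSemigroup
  using (interchange; x∙yz≈y∙xz)
open import Data.Nat.Tactic.RingSolver using (solve-∀)
open import Data.Product using (∃; _×_; _,_; proj₁; proj₂)
open import Data.Sum using (_⊎_; inj₁; inj₂)
open import Data.Unit using (tt)
open import Function using (_∘_)
open import Function.Bundles using (_⇔_; mk⇔; Equivalence)
open import Relation.Binary.Definitions using (DecidableEquality)
open import Relation.Binary.PropositionalEquality
open import Relation.Nullary using (does; yes; no; contradiction)
open import Relation.Nullary.Decidable using (dec-true; dec-false; from-yes)

bit : Bool → ℕ
bit true  = 1
bit false = 0

sumBelow : ℕ → (ℕ → ℕ) → ℕ
sumBelow zero    f = 0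
sumBelow (suc N) f = sumBelow N f + f N

syntax sumBelow N (λ i → e) = ∑[ i < N ] e

count : ℕ → (ℕ → Bool) → ℕ
count N f = ∑[ i < N ] bit (f i)

Periodic : {A : Set} → ℕ → (ℕ → A) → Set
Periodic p h = ∀ i → h (p + i) ≡ h i

module _ {f g : ℕ → ℕ} where

  ∑-cong : ∀ N → (∀ i → i < N → f i ≡ g i) → ∑[ i < N ] f i ≡ ∑[ i < N ] g i
  ∑-cong zero    f≡g = refl
  ∑-cong (suc N) f≡g = cong₂ _+_ (∑-cong N (λ i i<N → f≡g i (m<n⇒m<1+n i<N))) (f≡g N ≤-refl)

  ∑-mono-≤ : ∀ N → (∀ i → i < N → f i ≤ g i) → ∑[ i < N ] f i ≤ ∑[ i < N ] g i
  ∑-mono-≤ zero    f≤g = z≤n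
  ∑-mono-≤ (suc N) f≤g = +-mono-≤ (∑-mono-≤ N (λ i i<N → f≤g i (m<n⇒m<1+n i<N))) (f≤g N ≤-refl)

  ∑-distrib-+ : ∀ N → ∑[ i < N ] (f i + g i) ≡ ∑[ i < N ] f i + ∑[ i < N ] g i
  ∑-distrib-+ zero    = refl
  ∑-distrib-+ (suc N) rewrite ∑-distrib-+ N = interchange (∑[ i < N ] f i) (∑[ i < N ] g i) (f N) (g N)

∑-const : ∀ N c → ∑[ i < N ] c ≡ N * c
∑-const zero    c = refl
∑-const (suc N) c = trans (cong (_+ c) (∑-const N c)) (+-comm (N * c) c)

∑-pop-front : ∀ N (h : ℕ → ℕ) → ∑[ i < suc N ] h i ≡ h 0 + ∑[ i < N ] h (suc i)
∑-pop-front zero    h = +-comm 0 (h 0)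
∑-pop-front (suc N) h rewrite ∑-pop-front N h = +-assoc (h 0) _ _

∑-rotate : ∀ p (h : ℕ → ℕ) → h p ≡ h 0 → ∑[ i < p ] h (suc i) ≡ ∑[ i < p ] h i
∑-rotate p h hp≡h0 = +-cancelʳ-≡ (h 0) _ _ (begin
  ∑[ i < p ] h (suc i) + h 0  ≡⟨ +-comm _ (h 0) ⟩
  h 0 + ∑[ i < p ] h (suc i)  ≡⟨ ∑-pop-front p h ⟨
  ∑[ i < p ] h i + h p        ≡⟨ cong (∑[ i < p ] h i +_) hp≡h0 ⟩
  ∑[ i < p ] h i + h 0        ∎)
  where open ≡-Reasoning

Periodic-shift : ∀ {A : Set} {p} {h : ℕ → A} s → Periodic p h → Periodic p (λ i → h (s + i))
Periodic-shift {p = p} {h = h} s per i = trans (cong h (x∙yz≈y∙xz s p i)) (per (s + i))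

∑-periodic-shift : ∀ s p (h : ℕ → ℕ) → Periodic p h → ∑[ i < p ] h (s + i) ≡ ∑[ i < p ] h i
∑-periodic-shift zero    p h per = refl
∑-periodic-shift (suc s) p h per =
  trans (∑-periodic-shift s p (λ k → h (suc k)) (Periodic-shift 1 per))
        (∑-rotate p h (trans (cong h (sym (+-identityʳ p))) (per 0)))

∑-even-odd : ∀ m (f : ℕ → ℕ) →
  ∑[ i < m + m ] f i ≡ ∑[ j < m ] f (j + j) + ∑[ j < m ] f (suc (j + j))
∑-even-odd zero    f = refl
∑-even-odd (suc m) f rewrite +-suc m m | ∑-even-odd m f =
  trans (+-assoc (evens + odds) _ _) (interchange evens odds (f (m + m)) (f (suc (m + m))))
  where
  evens odds : ℕ
  evens = ∑[ j < m ] f (j + j)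
  odds  = ∑[ j < m ] f (suc (j + j))

module _ (f : ℕ → Bool) where

  count-none : ∀ N → (∀ i → i < N → f i ≡ false) → count N f ≡ 0
  count-none zero    none = refl
  count-none (suc N) none
    rewrite count-none N (λ i i<N → none i (m<n⇒m<1+n i<N)) | none N ≤-refl = refl

  count-pos : ∀ N {a} → a < N → f a ≡ true → 1 ≤ count N f
  count-pos (suc N) a<1+N fa with m<1+n⇒m<n∨m≡n a<1+N
  ... | inj₁ a<N  = ≤-trans (count-pos N a<N fa) (m≤m+n _ _)
  ... | inj₂ refl rewrite fa = m≤n+m 1 _

  count-≤1 : ∀ N → (∀ {a b} → a < N → b < N → f a ≡ true → f b ≡ true → a ≡ b) → count N f ≤ 1
  count-≤1 zero    unique = z≤n
  count-≤1 (suc N) unique with f N in fN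
  ... | false = subst (_≤ 1) (sym (+-identityʳ _))
                  (count-≤1 N (λ a<N b<N → unique (m<n⇒m<1+n a<N) (m<n⇒m<1+n b<N)))
  ... | true  = ≤-reflexive (cong (_+ 1) (count-none N others))
    where
    others : ∀ i → i < N → f i ≡ false
    others i i<N = ¬-not (λ fi → <-irrefl (unique (m<n⇒m<1+n i<N) ≤-refl fi fN) i<N)

count-insert : ∀ N {f f′ : ℕ → Bool} {t} → t < N → f t ≡ false → f′ t ≡ true →
  (∀ i → i ≢ t → f′ i ≡ f i) → count N f′ ≡ suc (count N f)
count-insert (suc N) {f} {f′} {t} t<1+N ft f′t elsewhere with m<1+n⇒m<n∨m≡n t<1+N
... | inj₁ t<N  = cong₂ _+_ (count-insert N t<N ft f′t elsewhere)
                            (cong bit (elsewhere N (≢-sym (<⇒≢ t<N))))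
... | inj₂ refl rewrite ft | f′t =
  trans (+-suc _ 0) (cong (λ c → suc (c + 0)) (∑-cong N λ i i<N → cong bit (elsewhere i (<⇒≢ i<N))))

ceil3≤ : ∀ a S → a ≤ 3 * S → ceil3 a ≤ S
ceil3≤ a S a≤3S = s≤s⁻¹ (m<n*o⇒m/o<n (begin-strict
  a + 2        <⟨ +-monoʳ-< a (n<1+n 2) ⟩
  a + 3        ≤⟨ +-monoˡ-≤ 3 a≤3S ⟩
  3 * S + 3    ≡⟨ cong (_+ 3) (*-comm 3 S) ⟩
  S * 3 + 3    ≡⟨ +-comm (S * 3) 3 ⟩
  suc S * 3    ∎))
  where open ≤-Reasoning

covered : (ℕ → Bool) → (ℕ → ℕ) → ℕ → Bool
covered w R a = w a ∨ w (R a)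

uncovered : (ℕ → Bool) → (ℕ → ℕ) → ℕ → Bool
uncovered w R a = not (covered w R a)

NoLone : (ℕ → Bool) → (ℕ → ℕ) → ℕ → Set
NoLone w R a = w a ∨ not (w (R a)) ∨ w (R (R a)) ≡ true

bit-pair : ∀ a b → a ∨ b ≡ true → 1 ≤ bit a + bit b
bit-pair true  b     _ = s≤s z≤n
bit-pair false true  _ = s≤s z≤n

bit-triple : ∀ a b c → a ∨ b ≡ true → b ∨ c ≡ true → a ∨ not b ∨ c ≡ true →
  2 ≤ bit a + bit b + bit c
bit-triple true  true  c     _ _ _ = s≤s (s≤s z≤n)
bit-triple true  false true  _ _ _ = s≤s (s≤s z≤n)
bit-triple false true  true  _ _ _ = s≤s (s≤s z≤n)
bit-triple true  false false _ () _
bit-triple false false _     () _ _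
bit-triple false true  false _ _ ()

bit-triple-gaps : ∀ a b c → a ∨ not b ∨ c ≡ true →
  2 ≤ (bit a + bit b + bit c) + (bit (not (a ∨ b)) + bit (not (b ∨ c)))
bit-triple-gaps true  true  c     _ = s≤s (s≤s z≤n)
bit-triple-gaps true  false true  _ = s≤s (s≤s z≤n)
bit-triple-gaps true  false false _ = s≤s (s≤s z≤n)
bit-triple-gaps false true  true  _ = s≤s (s≤s z≤n)
bit-triple-gaps false false true  _ = s≤s (s≤s z≤n)
bit-triple-gaps false false false _ = s≤s (s≤s z≤n)
bit-triple-gaps false true  false ()

-- Lower bound on the ones in a word of length M in which every pair a, 2 + a contains a one and no one is
-- lone (step 2): the triples a, a + 2, a + 4 and a + 1, a + 3, a + 5 need two ones each.
minWeight : ℕ → ℕ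
minWeight 0 = 0
minWeight 1 = 0
minWeight 2 = 0
minWeight 3 = 1
minWeight 4 = 2
minWeight 5 = 3
minWeight (suc (suc (suc (suc (suc (suc M)))))) = 4 + minWeight M

minWeight≤count : ∀ M (w : ℕ → Bool) →
  (∀ a → 2 + a < M → covered w (2 +_) a ≡ true) →
  (∀ a → 4 + a < M → NoLone w (2 +_) a) →
  minWeight M ≤ count M w
minWeight≤count 0 w cov noLone = z≤n
minWeight≤count 1 w cov noLone = z≤n
minWeight≤count 2 w cov noLone = z≤n
minWeight≤count 3 w cov noLone = begin
  1                      ≤⟨ bit-pair (w 0) (w 2) (cov 0 ≤-refl) ⟩
  b 0 + b 2              ≤⟨ m≤m+n _ (b 1) ⟩
  b 0 + b 2 + b 1        ≡⟨ regroup (b 0) (b 1) (b 2) ⟩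
  count 3 w              ∎
  where
  open ≤-Reasoning
  b : ℕ → ℕ
  b i = bit (w i)
  regroup : ∀ x y z → x + z + y ≡ 0 + x + y + z
  regroup = solve-∀
minWeight≤count 4 w cov noLone = begin
  2                          ≤⟨ +-mono-≤ (bit-pair (w 0) (w 2) (cov 0 (from-yes (2 <? 4))))
                                         (bit-pair (w 1) (w 3) (cov 1 ≤-refl)) ⟩
  (b 0 + b 2) + (b 1 + b 3)  ≡⟨ regroup (b 0) (b 1) (b 2) (b 3) ⟩
  count 4 w                  ∎
  where
  open ≤-Reasoning
  b : ℕ → ℕ
  b i = bit (w i)
  regroup : ∀ x y z t → (x + z) + (y + t) ≡ 0 + x + y + z + t
  regroup = solve-∀
minWeight≤count 5 w cov noLone = begin
  3                                ≤⟨ +-mono-≤ (bit-triple (w 0) (w 2) (w 4) (cov 0 (from-yes (2 <? 5)))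
                                                           (cov 2 ≤-refl) (noLone 0 ≤-refl))
                                               (bit-pair (w 1) (w 3) (cov 1 (from-yes (3 <? 5)))) ⟩
  (b 0 + b 2 + b 4) + (b 1 + b 3)  ≡⟨ regroup (b 0) (b 1) (b 2) (b 3) (b 4) ⟩
  count 5 w                        ∎
  where
  open ≤-Reasoning
  b : ℕ → ℕ
  b i = bit (w i)
  regroup : ∀ x y z t u → (x + z + u) + (y + t) ≡ 0 + x + y + z + t + u
  regroup = solve-∀
minWeight≤count (suc (suc (suc (suc (suc (suc M)))))) w cov noLone = begin
  4 + minWeight M                                            ≤⟨ +-mono-≤ (+-mono-≤ {2} {_} {2} evens odds) rest ⟩
  (b 0 + b 2 + b 4) + (b 1 + b 3 + b 5) + count M w          ≡⟨ regroup (count M w) (b 0) (b 1) (b 2) (b 3) (b 4) (b 5) ⟩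
  count (6 + M) w                                            ∎
  where
  open ≤-Reasoning
  b : ℕ → ℕ
  b k = bit (w (k + M))
  inBlock : ∀ {k} → k < 6 → k + M < 6 + M
  inBlock = +-monoˡ-< M
  evens : 2 ≤ b 0 + b 2 + b 4
  evens = bit-triple (w M) (w (2 + M)) (w (4 + M))
    (cov M (inBlock (from-yes (2 <? 6)))) (cov (2 + M) (inBlock (from-yes (4 <? 6))))
    (noLone M (inBlock (from-yes (4 <? 6))))
  odds : 2 ≤ b 1 + b 3 + b 5
  odds = bit-triple (w (1 + M)) (w (3 + M)) (w (5 + M))
    (cov (1 + M) (inBlock (from-yes (3 <? 6)))) (cov (3 + M) (inBlock ≤-refl))
    (noLone (1 + M) (inBlock ≤-refl))
  rest : minWeight M ≤ count M w
  rest = minWeight≤count M w (λ a 2+a<M → cov a (≤-trans 2+a<M (m≤n+m M 6)))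
                             (λ a 4+a<M → noLone a (≤-trans 4+a<M (m≤n+m M 6)))
  regroup : ∀ S x₀ x₁ x₂ x₃ x₄ x₅ →
    (x₀ + x₂ + x₄) + (x₁ + x₃ + x₅) + S ≡ S + x₀ + x₁ + x₂ + x₃ + x₄ + x₅
  regroup = solve-∀

∨-mono-true : ∀ {x y x′ y′} → (x ≡ true → x′ ≡ true) → (y ≡ true → y′ ≡ true) →
  x ∨ y ≡ true → x′ ∨ y′ ≡ true
∨-mono-true {true}  f g x∨y = cong (_∨ _) (f refl)
∨-mono-true {false} f g x∨y = trans (cong (_ ∨_) (g x∨y)) (∨-zeroʳ _)

∨-trueʳ : ∀ x {y} → y ≡ true → x ∨ y ≡ true
∨-trueʳ x y = trans (cong (x ∨_) y) (∨-zeroʳ x)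

module _ {w w′ : ℕ → Bool} (w⊆w′ : ∀ i → w i ≡ true → w′ i ≡ true) (R : ℕ → ℕ) (a : ℕ) where

  covered-mono : covered w R a ≡ true → covered w′ R a ≡ true
  covered-mono = ∨-mono-true (w⊆w′ a) (w⊆w′ (R a))

  NoLone-mono : w′ (R a) ≡ w (R a) → NoLone w R a → NoLone w′ R a
  NoLone-mono same = ∨-mono-true (w⊆w′ a)
    (∨-mono-true (λ lone → trans (cong not same) lone) (w⊆w′ (R (R a))))

-- Adding a one at 2 + e to a word whose only uncovered pair is e, 2 + e keeps NoLone, because the pair
-- 2 + e, 4 + e was covered.
module FillGap (n : ℕ) (w : ℕ → Bool) (noLone : ∀ a → 2 + a < n → NoLone w (2 +_) a)
  (unique : ∀ {a b} → a < n → b < n → covered w (2 +_) a ≡ false → covered w (2 +_) b ≡ false → a ≡ b)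
  {e : ℕ} (e<n : e < n) (uncov-e : covered w (2 +_) e ≡ false) where

  filled : ℕ → Bool
  filled i = w i ∨ does (i ≟ 2 + e)

  private
    w⊆filled : ∀ i → w i ≡ true → filled i ≡ true
    w⊆filled i wi = cong (_∨ _) wi

    filled[2+e] : filled (2 + e) ≡ true
    filled[2+e] = ∨-trueʳ (w (2 + e)) (dec-true (2 + e ≟ 2 + e) refl)

    w[2+e] : w (2 + e) ≡ false
    w[2+e] = ∨-conicalʳ (w e) (w (2 + e)) uncov-e

    elsewhere : ∀ i → i ≢ 2 + e → filled i ≡ w i
    elsewhere i i≢2+e = trans (cong (w i ∨_) (dec-false (i ≟ 2 + e) i≢2+e)) (∨-identityʳ (w i))

    covered-elsewhere : ∀ {a} → a < n → a ≢ e → covered w (2 +_) a ≡ true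
    covered-elsewhere a<n a≢e = ¬-not (λ uncov → a≢e (unique a<n e<n uncov uncov-e))

  count-filled : count (2 + n) filled ≡ suc (count (2 + n) w)
  count-filled = count-insert (2 + n) (s≤s (s≤s e<n)) w[2+e] filled[2+e] elsewhere

  filled-covered : ∀ a → 2 + a < 2 + n → covered filled (2 +_) a ≡ true
  filled-covered a 2+a<2+n with a ≟ e
  ... | yes refl = ∨-trueʳ (filled a) filled[2+e]
  ... | no a≢e   = covered-mono w⊆filled (2 +_) a (covered-elsewhere (s≤s⁻¹ (s≤s⁻¹ 2+a<2+n)) a≢e)

  filled-noLone : ∀ a → 4 + a < 2 + n → NoLone filled (2 +_) a
  filled-noLone a 4+a<2+n with a ≟ e
  ... | yes refl = ∨-trueʳ (filled a) (∨-trueʳ (not (filled (2 + a))) (w⊆filled (4 + a) w[4+e]))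
    where
    w[4+e] : w (4 + a) ≡ true
    w[4+e] = subst (λ x → x ∨ w (4 + a) ≡ true) w[2+e] (covered-elsewhere (s≤s⁻¹ (s≤s⁻¹ 4+a<2+n)) (λ ()))
  ... | no a≢e   = NoLone-mono w⊆filled (2 +_) a (elsewhere (2 + a) (a≢e ∘ suc-injective ∘ suc-injective))
                     (noLone a (s≤s⁻¹ (s≤s⁻¹ 4+a<2+n)))

minWeight≤count+uncovered : ∀ n (w : ℕ → Bool) →
  (∀ a → 2 + a < n → NoLone w (2 +_) a) →
  (∀ {a b} → a < n → b < n → covered w (2 +_) a ≡ false → covered w (2 +_) b ≡ false → a ≡ b) →
  minWeight (2 + n) ≤ count (2 + n) w + count n (uncovered w (2 +_))
minWeight≤count+uncovered n w noLone unique with anyUpTo? (λ a → covered w (2 +_) a ≟ᵇ false) n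
... | no none = ≤-trans (minWeight≤count (2 + n) w covered′ noLone′) (m≤m+n _ _)
  where
  covered′ : ∀ a → 2 + a < 2 + n → covered w (2 +_) a ≡ true
  covered′ a 2+a<2+n = ¬-not (λ uncov → none (a , s≤s⁻¹ (s≤s⁻¹ 2+a<2+n) , uncov))
  noLone′ : ∀ a → 4 + a < 2 + n → NoLone w (2 +_) a
  noLone′ a 4+a<2+n = noLone a (s≤s⁻¹ (s≤s⁻¹ 4+a<2+n))
... | yes (e , e<n , uncov-e) = begin
  minWeight (2 + n)                               ≤⟨ minWeight≤count (2 + n) filled filled-covered filled-noLone ⟩
  count (2 + n) filled                            ≡⟨ count-filled ⟩
  suc (count (2 + n) w)                           ≡⟨ +-comm 1 _ ⟩
  count (2 + n) w + 1                             ≤⟨ +-monoʳ-≤ _ (count-pos _ n e<n (cong not uncov-e)) ⟩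
  count (2 + n) w + count n (uncovered w (2 +_))  ∎
  where
  open ≤-Reasoning
  open FillGap n w noLone unique e<n uncov-e

CyclicWordBound : ℕ → ℕ → Set
CyclicWordBound p S = ∀ g → Periodic p g → (∀ i → NoLone g (2 +_) i) →
  S ≤ count p g + count p (uncovered g (2 +_))

module _ (p s : ℕ) (g : ℕ → Bool) (per : Periodic p g) (noLone : ∀ i → NoLone g (s +_) i) where

  private
    G F : ℕ → ℕ
    G i = bit (g i)
    F i = bit (uncovered g (s +_) i)

    ∑-shift : (h : ℕ → ℕ) → Periodic p h → ∑[ i < p ] h (s + i) ≡ ∑[ i < p ] h i
    ∑-shift = ∑-periodic-shift s p

    G-periodic : Periodic p G
    G-periodic i = cong bit (per i)

    F-periodic : Periodic p F
    F-periodic i = cong (λ b → bit (not b)) (cong₂ _∨_ (per i) (Periodic-shift s per i))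

  -- Each i starts a triple i, s + i, s + s + i whose ones and uncovered pairs number at least 2; summing
  -- over a period counts every one three times and every uncovered pair twice.
  cyclic-weight-bound : 2 * p ≤ 3 * count p g + 2 * count p (uncovered g (s +_))
  cyclic-weight-bound = begin
    2 * p                                     ≡⟨ trans (∑-const p 2) (*-comm p 2) ⟨
    ∑[ i < p ] 2                              ≤⟨ ∑-mono-≤ p (λ i _ → triple i) ⟩
    ∑[ i < p ] (T i + U i)                    ≡⟨ split ⟩
    (∑G + shifted G + shifted Gₛ) + (∑F + shifted F)
                                              ≡⟨ cong₂ _+_ (cong₂ _+_ (cong (∑G +_) (∑-shift G G-periodic)) Gₛ-shift)
                                                           (cong (∑F +_) (∑-shift F F-periodic)) ⟩
    (∑G + ∑G + ∑G) + (∑F + ∑F)                ≡⟨ collect ∑G ∑F ⟩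
    3 * ∑G + 2 * ∑F                           ∎
    where
    open ≤-Reasoning
    ∑G ∑F : ℕ
    ∑G = ∑[ i < p ] G i
    ∑F = ∑[ i < p ] F i
    Gₛ T U : ℕ → ℕ
    Gₛ i = G (s + i)
    T i = G i + G (s + i) + G (s + (s + i))
    U i = F i + F (s + i)
    shifted : (ℕ → ℕ) → ℕ
    shifted h = ∑[ i < p ] h (s + i)
    triple : ∀ i → 2 ≤ T i + U i
    triple i = bit-triple-gaps (g i) (g (s + i)) (g (s + (s + i))) (noLone i)
    split : ∑[ i < p ] (T i + U i) ≡ (∑G + shifted G + shifted Gₛ) + (∑F + shifted F)
    split = begin-equality
      ∑[ i < p ] (T i + U i)                                        ≡⟨ ∑-distrib-+ p ⟩
      ∑[ i < p ] T i + ∑[ i < p ] U i                               ≡⟨ cong₂ _+_ (∑-distrib-+ p) (∑-distrib-+ p) ⟩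
      ∑[ i < p ] (G i + G (s + i)) + shifted Gₛ + (∑F + shifted F)  ≡⟨ cong (λ x → x + shifted Gₛ + (∑F + shifted F)) (∑-distrib-+ p) ⟩
      (∑G + shifted G + shifted Gₛ) + (∑F + shifted F)              ∎
    Gₛ-shift : shifted Gₛ ≡ ∑G
    Gₛ-shift = trans (∑-shift Gₛ (Periodic-shift s G-periodic)) (∑-shift G G-periodic)
    collect : ∀ x y → (x + x + x) + (y + y) ≡ 3 * x + 2 * y
    collect = solve-∀

  ceil3-cyclic-bound : ceil3 (2 * p) ≤ count p g + count p (uncovered g (s +_))
  ceil3-cyclic-bound = ceil3≤ (2 * p) _ (≤-trans cyclic-weight-bound (3S+2F≤3[S+F] (count p g) _))
    where
    3S+2F≤3[S+F] : ∀ S F → 3 * S + 2 * F ≤ 3 * (S + F)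
    3S+2F≤3[S+F] S F = subst (3 * S + 2 * F ≤_) (sym (*-distribˡ-+ 3 S F))
                              (+-monoʳ-≤ (3 * S) (*-monoˡ-≤ F (from-yes (2 ≤? 3))))

-- For even period the word splits into its even and odd positions, each of them again
-- periodic, and a step of 2 in g is a step of 1 in either half.
module _ (m : ℕ) (g : ℕ → Bool) (per : Periodic (m + m) g) (noLone : ∀ i → NoLone g (2 +_) i) where

  private
    half : ℕ → ℕ → Bool
    half c j = g (c + (j + j))

    half-step : ∀ c j → c + ((1 + j) + (1 + j)) ≡ 2 + (c + (j + j))
    half-step = solve-∀

    half-periodic : ∀ c → Periodic m (half c)
    half-periodic c j = trans (cong g (regroup c m j)) (per (c + (j + j)))
      where
      regroup : ∀ c m j → c + ((m + j) + (m + j)) ≡ (m + m) + (c + (j + j))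
      regroup = solve-∀

    half-noLone : ∀ c j → NoLone (half c) (1 +_) j
    half-noLone c j = subst₂ (λ y z → g (c + (j + j)) ∨ not y ∨ z ≡ true)
      (cong g (sym (half-step c j)))
      (cong g (sym (trans (half-step c (suc j)) (cong (2 +_) (half-step c j)))))
      (noLone (c + (j + j)))

    count-uncovered-half : ∀ c →
      ∑[ j < m ] bit (uncovered g (2 +_) (c + (j + j))) ≡ count m (uncovered (half c) (1 +_))
    count-uncovered-half c = ∑-cong m (λ j _ → cong (λ x → bit (not (half c j ∨ g x))) (sym (half-step c j)))

  ceil3-even-cyclic-bound :
    2 * ceil3 (m + m) ≤ count (m + m) g + count (m + m) (uncovered g (2 +_))
  ceil3-even-cyclic-bound = begin
    2 * ceil3 (m + m)                            ≡⟨ cong (ceil3 (m + m) +_) (+-identityʳ _) ⟩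
    ceil3 (m + m) + ceil3 (m + m)                ≡⟨ cong (λ x → ceil3 x + ceil3 x) (cong (m +_) (+-identityʳ m)) ⟨
    ceil3 (2 * m) + ceil3 (2 * m)                ≤⟨ +-mono-≤ (bound 0) (bound 1) ⟩
    (S 0 + U 0) + (S 1 + U 1)                    ≡⟨ interchange (S 0) (U 0) (S 1) (U 1) ⟩
    (S 0 + S 1) + (U 0 + U 1)                    ≡⟨ cong₂ _+_ (∑-even-odd m (bit ∘ g)) uncovered-split ⟨
    count (m + m) g + count (m + m) (uncovered g (2 +_)) ∎
    where
    open ≤-Reasoning
    S U : ℕ → ℕ
    S c = count m (half c)
    U c = count m (uncovered (half c) (1 +_))
    bound : ∀ c → ceil3 (2 * m) ≤ S c + U c
    bound c = ceil3-cyclic-bound m 1 (half c) (half-periodic c) (half-noLone c)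
    uncovered-split : count (m + m) (uncovered g (2 +_)) ≡ U 0 + U 1
    uncovered-split = trans (∑-even-odd m _) (cong₂ _+_ (count-uncovered-half 0) (count-uncovered-half 1))

module _ {V : Set} {G : Graph V} {C : List (MV V)} (old : IsOLD (Mycielski G) C) where

  private
    dominating = proj₁ (proj₂ old)
    locating   = proj₂ (proj₂ old)

  shadow∈ : ∃ λ x → shadow x ∈ C
  shadow∈ with dominating root
  ... | shadow x , _ , x∈C = x , x∈C

  root∈ : ∀ x → (∀ j → G x j → vtx j ∈ C → ⊥) → root ∈ C
  root∈ x silent with dominating (shadow x)
  ... | root  , _    , root∈C = root∈C
  ... | vtx j , x~j  , j∈C    = ⊥-elim (silent j x~j j∈C)

  -- Shadows are pairwise non-adjacent and all adjacent to the root, so u_x and u_y are told apart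
  -- only by their neighbours v_j in C.
  shadow-locating : DecidableEquality V → ∀ x y →
    (∀ j → vtx j ∈ C → G x j → G y j) → (∀ j → vtx j ∈ C → G y j → G x j) → x ≡ y
  shadow-locating _≟_ x y x⊆y y⊆x with x ≟ y
  ... | yes x≡y = x≡y
  ... | no  x≢y = ⊥-elim (locating (shadow x) (shadow y) (λ { refl → x≢y refl }) same)
    where
    same : ∀ z → NC (Mycielski G) C (shadow x) z ⇔ NC (Mycielski G) C (shadow y) z
    same (vtx j)    = mk⇔ (λ (x~j , j∈C) → x⊆y j j∈C x~j , j∈C) (λ (y~j , j∈C) → y⊆x j j∈C y~j , j∈C)
    same (shadow j) = mk⇔ (λ ()) (λ ())
    same root       = mk⇔ (λ (_ , r∈C) → tt , r∈C) (λ (_ , r∈C) → tt , r∈C)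

module _ {V : Set} where

  #vtx #shadow #root : List (MV V) → ℕ
  #vtx []             = 0
  #vtx (vtx _ ∷ C)    = suc (#vtx C)
  #vtx (_ ∷ C)        = #vtx C
  #shadow []          = 0
  #shadow (shadow _ ∷ C) = suc (#shadow C)
  #shadow (_ ∷ C)     = #shadow C
  #root []            = 0
  #root (root ∷ C)    = suc (#root C)
  #root (_ ∷ C)       = #root C

  length-by-kind : ∀ C → #vtx C + #shadow C + #root C ≡ length C
  length-by-kind []             = refl
  length-by-kind (vtx _ ∷ C)    = cong suc (length-by-kind C)
  length-by-kind (shadow _ ∷ C) = trans (cong (_+ #root C) (+-suc (#vtx C) (#shadow C))) (cong suc (length-by-kind C))
  length-by-kind (root ∷ C)     = trans (+-suc (#vtx C + #shadow C) (#root C)) (cong suc (length-by-kind C))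

  #shadow-pos : ∀ {C x} → shadow x ∈ C → 1 ≤ #shadow C
  #shadow-pos {shadow _ ∷ C} _         = s≤s z≤n
  #shadow-pos {vtx _ ∷ C}    (there x∈C) = #shadow-pos x∈C
  #shadow-pos {root ∷ C}     (there x∈C) = #shadow-pos x∈C

  #root-pos : ∀ {C} → root ∈ C → 1 ≤ #root C
  #root-pos {root ∷ C}     _           = s≤s z≤n
  #root-pos {vtx _ ∷ C}    (there r∈C) = #root-pos r∈C
  #root-pos {shadow _ ∷ C} (there r∈C) = #root-pos r∈C

  occupied : (V → ℕ) → List (MV V) → ℕ → Bool
  occupied pos []             d = false
  occupied pos (vtx x ∷ C)    d = does (pos x ≟ d) ∨ occupied pos C d
  occupied pos (shadow _ ∷ C) d = occupied pos C d
  occupied pos (root ∷ C)     d = occupied pos C d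

  module _ (pos : V → ℕ) where

    occupied-complete : ∀ {C j} → vtx j ∈ C → occupied pos C (pos j) ≡ true
    occupied-complete {vtx _ ∷ C} {j} (here refl) rewrite dec-true (pos j ≟ pos j) refl = refl
    occupied-complete {vtx x ∷ C}    (there j∈C) = ∨-trueʳ (does (pos x ≟ _)) (occupied-complete j∈C)
    occupied-complete {shadow _ ∷ C} (there j∈C) = occupied-complete j∈C
    occupied-complete {root ∷ C}     (there j∈C) = occupied-complete j∈C

    count-occupied≤#vtx : ∀ N C → count N (occupied pos C) ≤ #vtx C
    count-occupied≤#vtx N []             = ≤-reflexive (count-none _ N (λ _ _ → refl))
    count-occupied≤#vtx N (vtx x ∷ C)    = begin
      count N (occupied pos (vtx x ∷ C))                             ≤⟨ ∑-mono-≤ N (λ d _ → bit-∨ (does (pos x ≟ d)) _) ⟩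
      ∑[ d < N ] (bit (does (pos x ≟ d)) + bit (occupied pos C d))  ≡⟨ ∑-distrib-+ N ⟩
      count N (λ d → does (pos x ≟ d)) + count N (occupied pos C)    ≤⟨ +-mono-≤ at-most-once (count-occupied≤#vtx N C) ⟩
      1 + #vtx C                                                     ∎
      where
      open ≤-Reasoning
      bit-∨ : ∀ a b → bit (a ∨ b) ≤ bit a + bit b
      bit-∨ true  b = s≤s z≤n
      bit-∨ false b = ≤-refl
      eq-sound : ∀ m n → does (m ≟ n) ≡ true → m ≡ n
      eq-sound m n m≟n = ≡ᵇ⇒≡ m n (Equivalence.from T-≡ m≟n)
      at-most-once : count N (λ d → does (pos x ≟ d)) ≤ 1
      at-most-once = count-≤1 _ N (λ _ _ x↦d x↦d′ → trans (sym (eq-sound (pos x) _ x↦d)) (eq-sound (pos x) _ x↦d′))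
    count-occupied≤#vtx N (shadow _ ∷ C) = count-occupied≤#vtx N C
    count-occupied≤#vtx N (root ∷ C)     = count-occupied≤#vtx N C

-- In M(G) the shadow of the centre at a sees, besides the root, exactly the C-vertices at positions
-- a and R a.
record Layout {V : Set} (G : Graph V) (pos : V → ℕ) (n : ℕ) (R : ℕ → ℕ) : Set where
  field
    centre           : ∀ {a} → a < n → V
    centre-injective : ∀ {a b} (a<n : a < n) (b<n : b < n) → centre a<n ≡ centre b<n → a ≡ b
    centre-adj       : ∀ {a} (a<n : a < n) j → G (centre a<n) j ⇔ (pos j ≡ a ⊎ pos j ≡ R a)

module _ {V : Set} (_≟V_ : DecidableEquality V) {G : Graph V} {pos : V → ℕ} {n : ℕ} {R : ℕ → ℕ}
         (layout : Layout G pos n R) {C : List (MV V)} (old : IsOLD (Mycielski G) C) where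

  open Layout layout

  private
    W : ℕ → Bool
    W = occupied pos C

    unoccupied : ∀ {d j} → W d ≡ false → vtx j ∈ C → pos j ≢ d
    unoccupied Wd j∈C refl with () ← trans (sym Wd) (occupied-complete pos j∈C)

    centre-silent : ∀ {a} (a<n : a < n) → covered W R a ≡ false → ∀ j → G (centre a<n) j → vtx j ∈ C → ⊥
    centre-silent {a} a<n uncov j a~j j∈C with Equivalence.to (centre-adj a<n j) a~j
    ... | inj₁ pj≡a  = unoccupied (∨-conicalˡ (W a) _ uncov) j∈C pj≡a
    ... | inj₂ pj≡Ra = unoccupied (∨-conicalʳ (W a) _ uncov) j∈C pj≡Ra

  uncovered⇒root∈ : ∀ {a} → a < n → covered W R a ≡ false → root ∈ C
  uncovered⇒root∈ a<n uncov = root∈ old _ (centre-silent a<n uncov)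

  uncovered-unique : ∀ {a b} → a < n → b < n → covered W R a ≡ false → covered W R b ≡ false → a ≡ b
  uncovered-unique a<n b<n uncov-a uncov-b = centre-injective a<n b<n
    (shadow-locating old _≟V_ _ _ (λ j j∈C a~j → ⊥-elim (centre-silent a<n uncov-a j a~j j∈C))
                                   (λ j j∈C b~j → ⊥-elim (centre-silent b<n uncov-b j b~j j∈C)))

  -- If only R a were occupied among a, R a, R (R a), the shadows of the centres at a and at R a
  -- would both see exactly position R a.
  occupied-NoLone : ∀ {a} → a < n → R a < n → NoLone W R a
  occupied-NoLone {a} a<n Ra<n with W a in Wa | W (R a) in WRa | W (R (R a)) in WRRa
  ... | true  | _     | _     = refl
  ... | false | false | _     = refl
  ... | false | true  | true  = refl
  ... | false | true  | false = contradiction (trans (sym WRa) (subst (λ d → W d ≡ false) a≡Ra Wa)) λ ()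
    where
    a⊆Ra : ∀ j → vtx j ∈ C → G (centre a<n) j → G (centre Ra<n) j
    a⊆Ra j j∈C a~j with Equivalence.to (centre-adj a<n j) a~j
    ... | inj₁ pj≡a  = ⊥-elim (unoccupied Wa j∈C pj≡a)
    ... | inj₂ pj≡Ra = Equivalence.from (centre-adj Ra<n j) (inj₁ pj≡Ra)
    Ra⊆a : ∀ j → vtx j ∈ C → G (centre Ra<n) j → G (centre a<n) j
    Ra⊆a j j∈C Ra~j with Equivalence.to (centre-adj Ra<n j) Ra~j
    ... | inj₁ pj≡Ra  = Equivalence.from (centre-adj a<n j) (inj₂ pj≡Ra)
    ... | inj₂ pj≡RRa = ⊥-elim (unoccupied WRRa j∈C pj≡RRa)
    a≡Ra : a ≡ R a
    a≡Ra = centre-injective a<n Ra<n (shadow-locating old _≟V_ _ _ a⊆Ra Ra⊆a)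

  count-uncovered≤#root : count n (uncovered W R) ≤ #root C
  count-uncovered≤#root with anyUpTo? (λ a → covered W R a ≟ᵇ false) n
  ... | yes (a , a<n , uncov) = ≤-trans (count-≤1 _ n unique) (#root-pos (uncovered⇒root∈ a<n uncov))
    where
    unique : ∀ {a b} → a < n → b < n → uncovered W R a ≡ true → uncovered W R b ≡ true → a ≡ b
    unique a<n b<n ua ub = uncovered-unique a<n b<n (not-injective ua) (not-injective ub)
  ... | no none = subst (_≤ #root C) (sym (count-none _ n all-covered)) z≤n
    where
    all-covered : ∀ a → a < n → uncovered W R a ≡ false
    all-covered a a<n = cong not (¬-not (λ uncov → none (a , a<n , uncov)))

  weight+uncovered<length : ∀ N → count N W + count n (uncovered W R) < length C
  weight+uncovered<length N = begin-strict
    count N W + count n (uncovered W R)  ≤⟨ +-mono-≤ (count-occupied≤#vtx pos N C) count-uncovered≤#root ⟩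
    #vtx C + #root C                                 <⟨ +-monoˡ-< (#root C) (m<m+n (#vtx C) (#shadow-pos (proj₂ (shadow∈ old)))) ⟩
    #vtx C + #shadow C + #root C                     ≡⟨ length-by-kind C ⟩
    length C                                         ∎
    where open ≤-Reasoning

γOLD≥-mono : ∀ {V : Set} {G : Graph V} {a b} → a ≤ b → γOLD≥ G b → γOLD≥ G a
γOLD≥-mono a≤b bound C old = ≤-trans a≤b (bound C old)

-- Vertex j sits at position j + 1, so positions 0 and n + 1 stand for the missing outer neighbours
-- of the two ends of the path.
path-layout : ∀ n → Layout (Path n) (λ j → suc (toℕ j)) n (2 +_)
path-layout n = record
  { centre           = λ a<n → fromℕ< a<n
  ; centre-injective = λ a<n b<n eq → trans (sym (toℕ-fromℕ< a<n)) (trans (cong toℕ eq) (toℕ-fromℕ< b<n))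
  ; centre-adj       = adj
  }
  where
  adj : ∀ {a} (a<n : a < n) j → Path n (fromℕ< a<n) j ⇔ (suc (toℕ j) ≡ a ⊎ suc (toℕ j) ≡ 2 + a)
  adj a<n j rewrite toℕ-fromℕ< a<n = mk⇔
    (λ { (inj₁ a+1≡j) → inj₂ (cong suc (sym a+1≡j)) ; (inj₂ j+1≡a) → inj₁ j+1≡a })
    (λ { (inj₁ j+1≡a) → inj₂ j+1≡a ; (inj₂ j+2≡a+2) → inj₁ (sym (suc-injective j+2≡a+2)) })

Mycielski-Path-bound : ∀ n → γOLD≥ (Mycielski (Path n)) (suc (minWeight (2 + n)))
Mycielski-Path-bound n C old = begin-strict
  minWeight (2 + n)                               ≤⟨ minWeight≤count+uncovered n W noLone (uncovered-unique _≟ᶠ_ layout old) ⟩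
  count (2 + n) W + count n (uncovered W (2 +_))  <⟨ weight+uncovered<length _≟ᶠ_ layout old (2 + n) ⟩
  length C                                        ∎
  where
  open ≤-Reasoning
  layout = path-layout n
  W : ℕ → Bool
  W = occupied (λ j → suc (toℕ j)) C
  noLone : ∀ a → 2 + a < n → NoLone W (2 +_) a
  noLone a 2+a<n = occupied-NoLone _≟ᶠ_ layout old (≤-trans (m≤n+m (suc a) 2) 2+a<n) 2+a<n

minWeight-6* : ∀ k c → minWeight (6 * k + c) ≡ 4 * k + minWeight c
minWeight-6* zero    c = refl
minWeight-6* (suc k) c = begin
  minWeight (6 * suc k + c)   ≡⟨ cong minWeight (trans (cong (_+ c) (*-suc 6 k)) (+-assoc 6 (6 * k) c)) ⟩
  4 + minWeight (6 * k + c)   ≡⟨ cong (4 +_) (minWeight-6* k c) ⟩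
  4 + (4 * k + minWeight c)   ≡⟨ +-assoc 4 (4 * k) (minWeight c) ⟨
  4 + 4 * k + minWeight c     ≡⟨ cong (_+ minWeight c) (*-suc 4 k) ⟨
  4 * suc k + minWeight c     ∎
  where open ≡-Reasoning

pathBound≡ : ∀ k r → r < 6 → pathBound k r ≡ suc (minWeight (2 + (6 * k + r)))
pathBound≡ k r r<6 = begin
  pathBound k r                         ≡⟨ by-residue r r<6 ⟩
  suc (4 * k + minWeight (2 + r))       ≡⟨ cong suc (minWeight-6* k (2 + r)) ⟨
  suc (minWeight (6 * k + (2 + r)))     ≡⟨ cong (suc ∘ minWeight) (x∙yz≈y∙xz (6 * k) 2 r) ⟩
  suc (minWeight (2 + (6 * k + r)))     ∎
  where
  open ≡-Reasoning
  by-residue : ∀ r → r < 6 → pathBound k r ≡ suc (4 * k + minWeight (2 + r))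
  by-residue 0 _ = +-comm _ 1
  by-residue 1 _ = +-comm _ 1
  by-residue 2 _ = +-comm _ 1
  by-residue 3 _ = +-comm _ 1
  by-residue 4 _ = +-comm _ 1
  by-residue 5 _ = +-suc (4 * k) 4
  by-residue (suc (suc (suc (suc (suc (suc _)))))) (s≤s (s≤s (s≤s (s≤s (s≤s (s≤s ()))))))

Mycielski-Path-pathBound : ∀ k r → r < 6 → γOLD≥ (Mycielski (Path (6 * k + r))) (pathBound k r)
Mycielski-Path-pathBound k r r<6 = γOLD≥-mono (≤-reflexive (pathBound≡ k r r<6)) (Mycielski-Path-bound (6 * k + r))

even⇒double : ∀ n → isOdd n ≡ false → ∃ λ m → m + m ≡ n
even⇒double zero          _    = 0 , refl
even⇒double (suc (suc n)) even with even⇒double n (trans (sym (not-involutive (isOdd n))) even)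
... | m , m+m≡n = suc m , cong suc (trans (+-suc m m) (cong suc m+m≡n))

module _ {n : ℕ} .{{_ : NonZero n}} where

  [m+n%d]%d≡[m+n]%d : ∀ m k → (m + k % n) % n ≡ (m + k) % n
  [m+n%d]%d≡[m+n]%d m k = begin
    (m + k % n) % n          ≡⟨ %-distribˡ-+ m (k % n) n ⟩
    (m % n + k % n % n) % n  ≡⟨ cong (λ x → (m % n + x) % n) (m%n%n≡m%n k n) ⟩
    (m % n + k % n) % n      ≡⟨ %-distribˡ-+ m k n ⟨
    (m + k) % n              ∎
    where open ≡-Reasoning

  suc%-cases : ∀ {x} → x < n → (suc x < n × suc x % n ≡ suc x) ⊎ (suc x ≡ n × suc x % n ≡ 0)
  suc%-cases x<n with m≤n⇒m<n∨m≡n x<n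
  ... | inj₁ 1+x<n  = inj₁ (1+x<n , m<n⇒m%n≡m 1+x<n)
  ... | inj₂ 1+x≡n = inj₂ (1+x≡n , trans (cong (_% n) 1+x≡n) (n%n≡0 n))

  suc%-injective : ∀ {x y} → x < n → y < n → suc x % n ≡ suc y % n → x ≡ y
  suc%-injective x<n y<n eq with suc%-cases x<n | suc%-cases y<n
  ... | inj₁ (_ , x′) | inj₁ (_ , y′) = suc-injective (trans (sym x′) (trans eq y′))
  ... | inj₁ (_ , x′) | inj₂ (_ , y′) with () ← trans (sym x′) (trans eq y′)
  ... | inj₂ (_ , x′) | inj₁ (_ , y′) with () ← trans (sym y′) (trans (sym eq) x′)
  ... | inj₂ (x+1≡n , _) | inj₂ (y+1≡n , _) = suc-injective (trans x+1≡n (sym y+1≡n))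

  suc%≡⇔ : ∀ {x y} → x < n → y < n → (suc x % n ≡ y) ⇔ (suc x ≡ y ⊎ (y ≡ 0 × suc x ≡ n))
  suc%≡⇔ {x} {y} x<n y<n with suc%-cases x<n
  ... | inj₁ (1+x<n , x′) = mk⇔ (λ eq → inj₁ (trans (sym x′) eq))
    λ { (inj₁ eq) → trans x′ eq ; (inj₂ (_ , 1+x≡n)) → ⊥-elim (<-irrefl 1+x≡n 1+x<n) }
  ... | inj₂ (1+x≡n , x′) = mk⇔ (λ eq → inj₂ (trans (sym eq) x′ , 1+x≡n))
    λ { (inj₁ eq) → ⊥-elim (<-irrefl (trans (sym eq) 1+x≡n) y<n) ; (inj₂ (y≡0 , _)) → trans x′ (sym y≡0) }

  Cycle⇔ : ∀ i j → Cycle n i j ⇔ (suc (toℕ i) % n ≡ toℕ j ⊎ suc (toℕ j) % n ≡ toℕ i)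
  Cycle⇔ i j = mk⇔ to from
    where
    forward  = suc%≡⇔ (toℕ<n i) (toℕ<n j)
    backward = suc%≡⇔ (toℕ<n j) (toℕ<n i)
    to : Cycle n i j → suc (toℕ i) % n ≡ toℕ j ⊎ suc (toℕ j) % n ≡ toℕ i
    to (inj₁ (inj₁ step))   = inj₁ (Equivalence.from forward  (inj₁ step))
    to (inj₁ (inj₂ step))   = inj₂ (Equivalence.from backward (inj₁ step))
    to (inj₂ (inj₁ wrap))   = inj₂ (Equivalence.from backward (inj₂ wrap))
    to (inj₂ (inj₂ wrap))   = inj₁ (Equivalence.from forward  (inj₂ wrap))
    from : suc (toℕ i) % n ≡ toℕ j ⊎ suc (toℕ j) % n ≡ toℕ i → Cycle n i j
    from (inj₁ eq) with Equivalence.to forward eq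
    ... | inj₁ step = inj₁ (inj₁ step)
    ... | inj₂ wrap = inj₂ (inj₂ wrap)
    from (inj₂ eq) with Equivalence.to backward eq
    ... | inj₁ step = inj₁ (inj₂ step)
    ... | inj₂ wrap = inj₂ (inj₁ wrap)

  cycle-layout : Layout (Cycle n) toℕ n (λ a → (2 + a) % n)
  cycle-layout = record
    { centre           = centre
    ; centre-injective = λ a<n b<n eq → suc%-injective a<n b<n
                           (trans (sym (centre-toℕ a<n)) (trans (cong toℕ eq) (centre-toℕ b<n)))
    ; centre-adj       = adj
    }
    where
    centre : ∀ {a} → a < n → Fin n
    centre {a} _ = fromℕ< (m%n<n (suc a) n)
    centre-toℕ : ∀ {a} (a<n : a < n) → toℕ (centre a<n) ≡ suc a % n
    centre-toℕ {a} _ = toℕ-fromℕ< (m%n<n (suc a) n)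
    adj : ∀ {a} (a<n : a < n) j → Cycle n (centre a<n) j ⇔ (toℕ j ≡ a ⊎ toℕ j ≡ (2 + a) % n)
    adj {a} a<n j = mk⇔ to from
      where
      c = centre a<n
      after-c : suc (toℕ c) % n ≡ (2 + a) % n
      after-c = trans (cong (λ x → suc x % n) (centre-toℕ a<n)) ([m+n%d]%d≡[m+n]%d 1 (suc a))
      to : Cycle n c j → toℕ j ≡ a ⊎ toℕ j ≡ (2 + a) % n
      to c~j with Equivalence.to (Cycle⇔ c j) c~j
      ... | inj₁ eq = inj₂ (trans (sym eq) after-c)
      ... | inj₂ eq = inj₁ (suc%-injective (toℕ<n j) a<n (trans eq (centre-toℕ a<n)))
      from : toℕ j ≡ a ⊎ toℕ j ≡ (2 + a) % n → Cycle n c j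
      from (inj₁ j≡a) = Equivalence.from (Cycle⇔ c j) (inj₂ (trans (cong (λ x → suc x % n) j≡a) (sym (centre-toℕ a<n))))
      from (inj₂ j≡R) = Equivalence.from (Cycle⇔ c j) (inj₁ (trans after-c (sym j≡R)))

  -- Reading C around the cycle gives a word of period n in which a step of 2 is the map a ↦ (2 + a) % n.
  Mycielski-Cycle-bound : ∀ S → CyclicWordBound n S → γOLD≥ (Mycielski (Cycle n)) (suc S)
  Mycielski-Cycle-bound S word-bound C old = begin-strict
    S                                            ≤⟨ word-bound g g-periodic g-noLone ⟩
    count n g + count n (uncovered g (2 +_))    ≡⟨ cong₂ _+_ (∑-cong n (λ i i<n → cong (bit ∘ W) (i%n≡i i<n)))
                                                              (∑-cong n (λ i i<n → cong (λ x → bit (not (W x ∨ W (R i)))) (i%n≡i i<n))) ⟩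
    count n W + count n (uncovered W R)         <⟨ weight+uncovered<length _≟ᶠ_ cycle-layout old n ⟩
    length C                                     ∎
    where
    open ≤-Reasoning
    R : ℕ → ℕ
    R a = (2 + a) % n
    W g : ℕ → Bool
    W = occupied toℕ C
    g i = W (i % n)
    i%n≡i : ∀ {i} → i < n → i % n ≡ i
    i%n≡i = m<n⇒m%n≡m
    step : ∀ i → (2 + i) % n ≡ R (i % n)
    step i = sym ([m+n%d]%d≡[m+n]%d 2 i)
    g-periodic : Periodic n g
    g-periodic i = cong W (trans (cong (_% n) (+-comm n i)) ([m+n]%n≡m%n i n))
    g-noLone : ∀ i → NoLone g (2 +_) i
    g-noLone i = subst₂ (λ y z → W (i % n) ∨ not (W y) ∨ W z ≡ true)
      (sym (step i)) (sym (trans (step (2 + i)) (cong R (step i))))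
      (occupied-NoLone _≟ᶠ_ cycle-layout old (m%n<n i n) (m%n<n (2 + i % n) n))

  Mycielski-Cycle-cycleBound : γOLD≥ (Mycielski (Cycle n)) (cycleBound n)
  Mycielski-Cycle-cycleBound with isOdd n in parity
  ... | true  = γOLD≥-mono (≤-reflexive (+-comm _ 1)) (Mycielski-Cycle-bound _ (ceil3-cyclic-bound n 2))
  ... | false with even⇒double n parity
  ...   | m , m+m≡n = γOLD≥-mono (≤-reflexive (+-comm _ 1)) (Mycielski-Cycle-bound _
          (subst (λ p → CyclicWordBound p (2 * ceil3 p)) m+m≡n (ceil3-even-cyclic-bound m)))

corollary2 : ((k r : ℕ) → 1 ≤ k → r < 6 →
    γOLD≥ (Mycielski (Path (6 * k + r))) (pathBound k r))
    ×
    ((n : ℕ) → 3 ≤ n → n ≢ 4 →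
    γOLD≥ (Mycielski (Cycle n)) (cycleBound n))
corollary2 = (λ k r _ → Mycielski-Path-pathBound k r) , λ { (suc n) _ _ → Mycielski-Cycle-cycleBound }
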